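{- For any $1\le k\le n$, in MMB with $n$ leaves the membership proof of the $k$-th most recent item consists of at most $2\lfloor\log_2 k\rfloor+3$ hashes.
   Context: A mountain of height $s\ge0$ is a perfect binary tree with $2^s$ leaves; its root is its peak. The U-MMB with $n$ leaves is an ordered (left-to-right) list of mountains whose leaves read left to right are $h_1,\dots,h_n$, built inductively from the empty list: the $n$-th append (1) adds $h_n$ as a height-0 mountain at the right end, and (2) if there exist two consecutive mountains of equal height, takes the rightmost such pair, of height $s$, and replaces it in place by a mountain of height $s+1$ whose new peak has the two old peaks as children. MMB partitions the mountains into ranges: consecutive mountains $M,M'$ ($M$ left of $M'$) are in different ranges iff their heights differ by 2, or the mountain immediately left of $M$ exists and has the same height as $M$. For a range with peaks $P_1,\dots,P_r$, range nodes are $R_1$ (single child $P_1$) and $R_j$ with children $R_{j-1},P_j$; $R_r$ is the range root. For range roots $Q_1,\dots,Q_q$ (left to right), belt nodes are $B_1$ (single child $Q_1$) and $B_j$ with children $B_{j-1},Q_j$; $B_q$ is the root. The membership proof of a leaf is the list of hashes of siblings of the nodes on the path from the leaf to the root (a node without sibling contributes no hash). The $k$-th most recent item corresponds to leaf $h_{n-k+1}$. -}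

module Defs where

open import Data.Nat using (ℕ; zero; suc; _+_; _≟_)
open import Data.Bool using (Bool; true; false; _∨_; if_then_else_)
open import Data.List using (List; []; _∷_; _++_; [_])
open import Data.List.NonEmpty using (List⁺; _∷_; _∷⁺_) renaming ([_] to [_]⁺)
open import Data.Maybe using (Maybe; just; nothing)
open import Data.Product using (_×_; _,_; proj₁; proj₂)
open import Relation.Nullary.Decidable using (⌊_⌋)

-- Binary trees with possibly-unary internal nodes (range/belt nodes may
-- have a single child).  Leaves carry their index i (leaf h_i).
data Tree : Set where
  leaf  : ℕ → Tree
  node1 : Tree → Tree
  node2 : Tree → Tree → Tree

Mountain : Set
Mountain = ℕ × Tree

height : Mountain → ℕ
height = proj₁

eqℕ : ℕ → ℕ → Bool
eqℕ a b = ⌊ a ≟ b ⌋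

mergeRightmost : List Mountain → Maybe (List Mountain)
mergeRightmost [] = nothing
mergeRightmost (x ∷ []) = nothing
mergeRightmost (x ∷ y ∷ rest) with mergeRightmost (y ∷ rest)
... | just l = just (x ∷ l)
... | nothing =
  if eqℕ (height x) (height y)
  then just ((suc (height x) , node2 (proj₂ x) (proj₂ y)) ∷ rest)
  else nothing

append : ℕ → List Mountain → List Mountain
append n ms with mergeRightmost (ms ++ [ (0 , leaf n) ])
... | just ms' = ms'
... | nothing  = ms ++ [ (0 , leaf n) ]

-- U-MMB with n leaves h_1 … h_n (leaf h_i is labelled i).
ummb : ℕ → List Mountain
ummb zero = []
ummb (suc n) = append (suc n) (ummb n)

sameAsPrev : Maybe ℕ → ℕ → Bool
sameAsPrev nothing _ = false
sameAsPrev (just p) h = eqℕ p h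

boundary : Maybe ℕ → Mountain → Mountain → Bool
boundary prev M M' =
  eqℕ (height M) (2 + height M') ∨ eqℕ (height M') (2 + height M)
    ∨ sameAsPrev prev (height M)

consHead : Mountain → List⁺ (List⁺ Mountain) → List⁺ (List⁺ Mountain)
consHead m (g ∷ gs) = (m ∷⁺ g) ∷ gs

-- go prev M rest : ranges of M ∷ rest, where prev is the height of the
-- mountain immediately left of M (if any).
rangesFrom : Maybe ℕ → Mountain → List Mountain → List⁺ (List⁺ Mountain)
rangesFrom p m [] = [ [ m ]⁺ ]⁺
rangesFrom p m (m' ∷ ms) =
  if boundary p m m'
  then [ m ]⁺ ∷⁺ rangesFrom (just (height m)) m' ms
  else consHead m (rangesFrom (just (height m)) m' ms)

ranges : Mountain → List Mountain → List⁺ (List⁺ Mountain)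
ranges m ms = rangesFrom nothing m ms

chainFrom : Tree → List Tree → Tree
chainFrom acc [] = acc
chainFrom acc (t ∷ ts) = chainFrom (node2 acc t) ts

chain : List⁺ Tree → Tree
chain (t ∷ ts) = chainFrom (node1 t) ts

rangeRoot : List⁺ Mountain → Tree
rangeRoot g = chain (Data.List.NonEmpty.map proj₂ g)

mmbRoot : ℕ → Maybe Tree
mmbRoot n with ummb n
... | [] = nothing
... | m ∷ ms = just (chain (Data.List.NonEmpty.map rangeRoot (ranges m ms)))

-- Membership proof of leaf i: siblings of the nodes on the path from the
-- leaf to the root, bottom-up (a hash is represented by the sibling subtree
-- whose hash it is).  nothing if leaf i does not occur.
proofIn : ℕ → Tree → Maybe (List Tree)
proofIn i (leaf j) = if eqℕ i j then just [] else nothing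
proofIn i (node1 t) = proofIn i t
proofIn i (node2 l r) with proofIn i l
... | just p = just (p ++ [ r ])
... | nothing with proofIn i r
...   | just p = just (p ++ [ l ])
...   | nothing = nothing

membershipProof : ℕ → ℕ → Maybe (List Tree)
membershipProof n i with mmbRoot n
... | nothing = nothing
... | just t = proofIn i t

-- Invariant of U-MMB: a mountain with j mountains to its right has height j or j + 1;
-- appending a height-0 mountain and merging the rightmost equal pair preserves it.  So the
-- k-th most recent leaf lies in a mountain of height at most j + 1 whose j right neighbours
-- hold at least 2 ^ j - 1 leaves, whence 2 ^ j ≤ k.  In a chain of trees a leaf's proof is
-- its proof inside its own tree, one hash per later tree, and at most one hash more.  Ranges
-- and the belt form a chain of chains, and every later range contains a later mountain, so
-- the proof has at most (j + 1) + j + 2 hashes.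
{-# OPTIONS --safe #-}
module Submission where

open import Defs
open import Data.Nat using (ℕ; zero; suc; _+_; _*_; _∸_; _^_; _≤_; _<_; z≤n; s≤s)
open import Data.Nat.Properties
open import Data.Nat.Logarithm using (⌊log₂_⌋; ⌊log₂⌋-mono-≤; ⌊log₂[2^n]⌋≡n)
open import Data.Nat.Tactic.RingSolver using (solve-∀)
open import Data.List using (List; []; _∷_; _++_; [_]; length; map; concat)
open import Data.List.Properties using (length-++; length-map; map-++)
import Data.List.NonEmpty as List⁺
open import Data.List.NonEmpty using (List⁺; _∷_; _∷⁺_; toList)
open import Data.Maybe using (Maybe; just; nothing; _<∣>_) renaming (map to mapᴹ)
import Data.Maybe.Relation.Binary.Pointwise as Pointwise
open import Data.Maybe.Relation.Binary.Pointwise using (Pointwise; just; nothing)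
open import Data.Product using (∃-syntax; _×_; _,_; proj₂)
open import Data.Sum using (_⊎_; inj₁; inj₂)
open import Function using (_∘_)
open import Data.Bool using (true; false; if_then_else_)
open import Relation.Nullary using (yes; no; contradiction)
open import Relation.Binary.PropositionalEquality
  using (_≡_; _≢_; refl; sym; trans; cong; subst; subst₂; cong₂; module ≡-Reasoning)

length-∷ʳ : ∀ {A : Set} (xs : List A) (y : A) → length (xs ++ [ y ]) ≡ suc (length xs)
length-∷ʳ xs y = trans (length-++ xs) (+-comm (length xs) 1)

length≤length-concat⁺ : ∀ {A : Set} (xss : List (List⁺ A)) → length xss ≤ length (concat (map toList xss))
length≤length-concat⁺ [] = z≤n
length≤length-concat⁺ ((x ∷ xs) ∷ xss) = s≤s (begin
  length xss                                 ≤⟨ length≤length-concat⁺ xss ⟩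
  length (concat (map toList xss))           ≤⟨ m≤n+m _ (length xs) ⟩
  length xs + length (concat (map toList xss)) ≡⟨ length-++ xs ⟨
  length (xs ++ concat (map toList xss))     ∎)
  where open ≤-Reasoning

2^[1+h]+a≡2^h+[2^h+a] : ∀ h a → 2 ^ suc h + a ≡ 2 ^ h + (2 ^ h + a)
2^[1+h]+a≡2^h+[2^h+a] h a =
  trans (cong (λ p → 2 ^ h + p + a) (+-identityʳ (2 ^ h))) (+-assoc (2 ^ h) (2 ^ h) a)

1+n+n≡2*n+1 : ∀ n → suc n + n ≡ 2 * n + 1
1+n+n≡2*n+1 = solve-∀

2+[2*n+1]≡2*n+3 : ∀ n → 2 + (2 * n + 1) ≡ 2 * n + 3
2+[2*n+1]≡2*n+3 = solve-∀

proofLength : ℕ → Tree → Maybe ℕ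
proofLength x t = mapᴹ length (proofIn x t)

proofLength-leaf : ∀ x → proofLength x (leaf x) ≡ just 0
proofLength-leaf x with x ≟ x
... | yes _   = refl
... | no x≢x = contradiction refl x≢x

proofLength-leaf-≢ : ∀ {x y} → x ≢ y → proofLength x (leaf y) ≡ nothing
proofLength-leaf-≢ {x} {y} x≢y with x ≟ y
... | yes x≡y = contradiction x≡y x≢y
... | no _    = refl

proofLength-node2 : ∀ x l r →
  proofLength x (node2 l r) ≡ mapᴹ suc (proofLength x l) <∣> mapᴹ suc (proofLength x r)
proofLength-node2 x l r with proofIn x l
... | just p = cong just (length-∷ʳ p r)
... | nothing with proofIn x r
...   | just p  = cong just (length-∷ʳ p l)
...   | nothing = refl

chainCost : ℕ → List Tree → Maybe ℕ
chainCost x []       = nothing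
chainCost x (t ∷ ts) = mapᴹ (_+ length ts) (proofLength x t) <∣> chainCost x ts

chainCost-++ : ∀ x ts us →
  chainCost x (ts ++ us) ≡ mapᴹ (_+ length us) (chainCost x ts) <∣> chainCost x us
chainCost-++ x []       us = refl
chainCost-++ x (t ∷ ts) us with proofLength x t
... | just l  = cong just (trans (cong (l +_) (length-++ ts)) (sym (+-assoc l (length ts) (length us))))
... | nothing = chainCost-++ x ts us

proofLength-chainFrom : ∀ x acc ts →
  proofLength x (chainFrom acc ts)
    ≡ mapᴹ (_+ length ts) (proofLength x acc) <∣> mapᴹ suc (chainCost x ts)
proofLength-chainFrom x acc [] with proofLength x acc
... | just l  = cong just (sym (+-identityʳ l))
... | nothing = refl
proofLength-chainFrom x acc (t ∷ ts) = begin
  proofLength x (chainFrom (node2 acc t) ts)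
    ≡⟨ proofLength-chainFrom x (node2 acc t) ts ⟩
  mapᴹ (_+ length ts) (proofLength x (node2 acc t)) <∣> mapᴹ suc (chainCost x ts)
    ≡⟨ cong (λ u → mapᴹ (_+ length ts) u <∣> mapᴹ suc (chainCost x ts)) (proofLength-node2 x acc t) ⟩
  mapᴹ (_+ length ts) (mapᴹ suc (proofLength x acc) <∣> mapᴹ suc (proofLength x t))
    <∣> mapᴹ suc (chainCost x ts)
    ≡⟨ regroup (proofLength x acc) (proofLength x t) ⟩
  mapᴹ (_+ suc (length ts)) (proofLength x acc)
    <∣> mapᴹ suc (mapᴹ (_+ length ts) (proofLength x t) <∣> chainCost x ts) ∎
  where
  open ≡-Reasoning
  regroup : ∀ u v →
    mapᴹ (_+ length ts) (mapᴹ suc u <∣> mapᴹ suc v) <∣> mapᴹ suc (chainCost x ts)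
      ≡ mapᴹ (_+ suc (length ts)) u <∣> mapᴹ suc (mapᴹ (_+ length ts) v <∣> chainCost x ts)
  regroup (just l) _        = cong just (sym (+-suc l (length ts)))
  regroup nothing (just l)  = refl
  regroup nothing nothing   = refl

AtMostPlus : ℕ → Maybe ℕ → Maybe ℕ → Set
AtMostPlus c = Pointwise (λ e d → e ≤ c + d)

<∣>-atMostPlus : ∀ {c m m' u u' v v'} → AtMostPlus c u u' → m ≤ m' → AtMostPlus c v v' →
  AtMostPlus c (mapᴹ (_+ m) u <∣> v) (mapᴹ (_+ m') u' <∣> v')
<∣>-atMostPlus {c} {m} {m'} (just {e} {d} e≤c+d) m≤m' _ =
  just (≤-trans (+-mono-≤ e≤c+d m≤m') (≤-reflexive (+-assoc c d m')))
<∣>-atMostPlus nothing _ v≤v' = v≤v'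

mapᴹ-suc-atMostPlus : ∀ u → AtMostPlus 1 (mapᴹ suc u) u
mapᴹ-suc-atMostPlus (just d) = just ≤-refl
mapᴹ-suc-atMostPlus nothing  = nothing

proofLength-chain : ∀ x t ts → AtMostPlus 1 (proofLength x (chain (t ∷ ts))) (chainCost x (t ∷ ts))
proofLength-chain x t ts =
  subst (λ u → AtMostPlus 1 u (chainCost x (t ∷ ts))) (sym (proofLength-chainFrom x (node1 t) ts))
    (<∣>-atMostPlus {u = proofLength x t} (Pointwise.refl (λ {n} → n≤1+n n)) (≤-refl {length ts})
      (mapᴹ-suc-atMostPlus (chainCost x ts)))

module _ {A : Set} (x : ℕ) (f : A → Tree) where

  chainCost-chains : ∀ (gs : List (List⁺ A)) →
    AtMostPlus 1 (chainCost x (map (chain ∘ List⁺.map f) gs))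
                 (chainCost x (map f (concat (map toList gs))))
  chainCost-chains [] = nothing
  chainCost-chains ((a ∷ as) ∷ gs) =
    subst (AtMostPlus 1 _) (sym split)
      (<∣>-atMostPlus {u = proofLength x (chain (f a ∷ map f as))} {u' = chainCost x (f a ∷ map f as)}
        (proofLength-chain x (f a) (map f as)) fewer (chainCost-chains gs))
    where
    rest : List Tree
    rest = map f (concat (map toList gs))
    split : chainCost x (map f ((a ∷ as) ++ concat (map toList gs)))
              ≡ mapᴹ (_+ length rest) (chainCost x (f a ∷ map f as)) <∣> chainCost x rest
    split = trans (cong (chainCost x) (map-++ f (a ∷ as) _)) (chainCost-++ x (f a ∷ map f as) rest)
    fewer : length (map (chain ∘ List⁺.map f) gs) ≤ length rest
    fewer = subst₂ _≤_ (sym (length-map (chain ∘ List⁺.map f) gs)) (sym (length-map f (concat (map toList gs))))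
              (length≤length-concat⁺ gs)

  proofLength-chain-of-chains : ∀ (gss : List⁺ (List⁺ A)) →
    AtMostPlus 2 (proofLength x (chain (List⁺.map (chain ∘ List⁺.map f) gss)))
                 (chainCost x (map f (concat (map toList (toList gss)))))
  proofLength-chain-of-chains ((a ∷ as) ∷ gs) =
    Pointwise.trans (λ p q → ≤-trans p (s≤s q))
      (proofLength-chain x (chain (f a ∷ map f as)) (map (chain ∘ List⁺.map f) gs))
      (chainCost-chains ((a ∷ as) ∷ gs))

-- The leaves of T are a + 1, …, 2 ^ h + a, from left to right.
data Perfect : ℕ → ℕ → Tree → Set where
  leaf  : ∀ {a} → Perfect 0 a (leaf (suc a))
  node2 : ∀ {h a l r} → Perfect h a l → Perfect h (2 ^ h + a) r → Perfect (suc h) a (node2 l r)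

proofLength-perfect-outside : ∀ {h a T} x → Perfect h a T → x ≤ a ⊎ 2 ^ h + a < x →
  proofLength x T ≡ nothing
proofLength-perfect-outside x leaf (inj₁ x≤a) = proofLength-leaf-≢ (<⇒≢ (s≤s x≤a))
proofLength-perfect-outside x leaf (inj₂ 1+a<x) = proofLength-leaf-≢ (>⇒≢ 1+a<x)
proofLength-perfect-outside {suc h} {a} x (node2 {l = l} {r = r} L R) outside =
  trans (proofLength-node2 x l r)
    (cong₂ (λ u v → mapᴹ suc u <∣> mapᴹ suc v)
      (proofLength-perfect-outside x L (outsideˡ outside))
      (proofLength-perfect-outside x R (outsideʳ outside)))
  where
  outsideˡ : x ≤ a ⊎ 2 ^ suc h + a < x → x ≤ a ⊎ 2 ^ h + a < x
  outsideˡ (inj₁ x≤a) = inj₁ x≤a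
  outsideˡ (inj₂ <x) = inj₂ (≤-<-trans (+-monoˡ-≤ a (^-monoʳ-≤ 2 (n≤1+n h))) <x)
  outsideʳ : x ≤ a ⊎ 2 ^ suc h + a < x → x ≤ 2 ^ h + a ⊎ 2 ^ h + (2 ^ h + a) < x
  outsideʳ (inj₁ x≤a) = inj₁ (≤-trans x≤a (m≤n+m a (2 ^ h)))
  outsideʳ (inj₂ <x) = inj₂ (subst (_< x) (2^[1+h]+a≡2^h+[2^h+a] h a) <x)

proofLength-perfect-inside : ∀ {h a T} x → Perfect h a T → a < x → x ≤ 2 ^ h + a →
  proofLength x T ≡ just h
proofLength-perfect-inside {a = a} x leaf a<x x≤1+a
  rewrite ≤-antisym x≤1+a a<x = proofLength-leaf (suc a)
proofLength-perfect-inside {suc h} {a} x (node2 {l = l} {r = r} L R) a<x x≤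
  rewrite proofLength-node2 x l r with x ≤? 2 ^ h + a
... | yes x≤mid rewrite proofLength-perfect-inside x L a<x x≤mid = refl
... | no x≰mid
  rewrite proofLength-perfect-outside x L (inj₂ (≰⇒> x≰mid))
        | proofLength-perfect-inside x R (≰⇒> x≰mid) (subst (x ≤_) (2^[1+h]+a≡2^h+[2^h+a] h a) x≤) = refl

data Layout : ℕ → List Mountain → ℕ → Set where
  []   : ∀ {a} → Layout a [] a
  cons : ∀ {a b h T ms} → Perfect h a T → length ms ≤ h → h ≤ suc (length ms) →
         Layout (2 ^ h + a) ms b → Layout a ((h , T) ∷ ms) b

layout-size : ∀ {a ms b} → Layout a ms b → 2 ^ length ms + a ≤ suc b
layout-size []                               = ≤-refl
layout-size {a} {b = b} (cons {h = h} {ms = ms} _ j≤h _ L) = begin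
  2 ^ suc (length ms) + a             ≡⟨ 2^[1+h]+a≡2^h+[2^h+a] (length ms) a ⟩
  2 ^ length ms + (2 ^ length ms + a) ≤⟨ +-monoʳ-≤ (2 ^ length ms) (+-monoˡ-≤ a (^-monoʳ-≤ 2 j≤h)) ⟩
  2 ^ length ms + (2 ^ h + a)         ≤⟨ layout-size L ⟩
  suc b                               ∎
  where open ≤-Reasoning

layout-chainCost : ∀ x {a ms b} → Layout a ms b → a < x → x ≤ b →
  ∃[ j ] ∃[ D ] (chainCost x (map proj₂ ms) ≡ just D × D ≤ 2 * j + 1 × 2 ^ j + x ≤ suc b)
layout-chainCost x [] a<x x≤a = contradiction (≤-trans a<x x≤a) (n≮n _)
layout-chainCost x {a} (cons {h = h} {ms = ms} P j≤h h≤1+j L) a<x x≤b with x ≤? 2 ^ h + a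
... | yes x≤mid rewrite proofLength-perfect-inside x P a<x x≤mid =
  length ms , h + length (map proj₂ ms) , refl , depth , ≤-trans (+-monoʳ-≤ (2 ^ length ms) x≤mid) (layout-size L)
  where
  depth : h + length (map proj₂ ms) ≤ 2 * length ms + 1
  depth = begin
    h + length (map proj₂ ms) ≡⟨ cong (h +_) (length-map proj₂ ms) ⟩
    h + length ms             ≤⟨ +-monoˡ-≤ (length ms) h≤1+j ⟩
    suc (length ms) + length ms ≡⟨ 1+n+n≡2*n+1 (length ms) ⟩
    2 * length ms + 1 ∎
    where open ≤-Reasoning
... | no x≰mid rewrite proofLength-perfect-outside x P (inj₂ (≰⇒> x≰mid)) =
  layout-chainCost x L (≰⇒> x≰mid) x≤b

newLeaf : ℕ → Mountain
newLeaf b = 0 , leaf (suc b)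

AppendLayout : ℕ → List Mountain → ℕ → Maybe (List Mountain) → Set
AppendLayout a ms b nothing    = Layout a (ms ++ [ newLeaf b ]) (suc b)
AppendLayout a ms b (just ms') = Layout a ms' (suc b) × length ms' ≡ length ms

mergeRightmost-layout : ∀ {a b} ms → Layout a ms b →
  AppendLayout a ms b (mergeRightmost (ms ++ [ newLeaf b ]))
mergeRightmost-layout [] [] = cons leaf z≤n z≤n []
mergeRightmost-layout ((0 , _) ∷ []) (cons leaf _ _ []) = cons (node2 leaf leaf) z≤n (s≤s z≤n) [] , refl
mergeRightmost-layout ((1 , _) ∷ []) (cons P _ _ []) = cons P (s≤s z≤n) (s≤s z≤n) (cons leaf z≤n z≤n [])
mergeRightmost-layout ((suc (suc _) , _) ∷ []) (cons _ _ (s≤s ()) _)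
mergeRightmost-layout {b = b} ((h , _) ∷ y ∷ ms) (cons P j≤h h≤1+j L)
  with mergeRightmost (y ∷ ms ++ [ newLeaf b ]) | mergeRightmost-layout (y ∷ ms) L
... | just ms' | L' , same-length =
  cons P (subst (_≤ h) (sym same-length) j≤h) (subst (λ j → h ≤ suc j) (sym same-length) h≤1+j) L' ,
  cong suc same-length
mergeRightmost-layout {a} {b} ((h , _) ∷ (hy , _) ∷ ms) (cons P j≤h h≤1+j (cons _ _ hy≤1+j _))
  | nothing | L'@(cons Py j'≤hy _ L'') with h ≟ hy
... | yes refl =
  cons (node2 P Py) (m≤n⇒m≤1+n j'≤hy) (s≤s (subst (h ≤_) (sym (length-∷ʳ ms (newLeaf b))) hy≤1+j))
    (subst (λ c → Layout c (ms ++ [ newLeaf b ]) (suc b)) (sym (2^[1+h]+a≡2^h+[2^h+a] h a)) L'') ,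
  cong suc (length-∷ʳ ms (newLeaf b))
... | no h≢hy =
  cons P (subst (λ j → suc j ≤ h) (sym (length-∷ʳ ms (newLeaf b))) 2+j≤h)
    (m≤n⇒m≤1+n (subst (λ j → h ≤ suc j) (sym (length-∷ʳ ms (newLeaf b))) h≤1+j))
    L'
  where
  hy≡1+j : hy ≡ suc (length ms)
  hy≡1+j = ≤-antisym hy≤1+j (subst (_≤ hy) (length-∷ʳ ms (newLeaf b)) j'≤hy)
  2+j≤h : suc (suc (length ms)) ≤ h
  2+j≤h = ≤∧≢⇒< j≤h (λ 1+j≡h → h≢hy (trans (sym 1+j≡h) (sym hy≡1+j)))

layout-ummb : ∀ n → Layout 0 (ummb n) n
layout-ummb zero = []
layout-ummb (suc n)
  with mergeRightmost (ummb n ++ [ newLeaf n ]) | mergeRightmost-layout (ummb n) (layout-ummb n)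
... | just _  | L , _ = L
... | nothing | L     = L

concat-ifConsHead : ∀ β m gss →
  concat (map toList (toList (if β then List⁺.[ m ] ∷⁺ gss else consHead m gss)))
    ≡ m ∷ concat (map toList (toList gss))
concat-ifConsHead true  m gss             = refl
concat-ifConsHead false m ((_ ∷ _) ∷ _) = refl

concat-rangesFrom : ∀ p m ms → concat (map toList (toList (rangesFrom p m ms))) ≡ m ∷ ms
concat-rangesFrom p m []        = refl
concat-rangesFrom p m (m' ∷ ms) =
  trans (concat-ifConsHead (boundary p m m') m (rangesFrom _ m' ms))
        (cong (m ∷_) (concat-rangesFrom _ m' ms))

proofIn-atMostPlus : ∀ {c D} x t → AtMostPlus c (proofLength x t) (just D) →
  ∃[ ps ] (proofIn x t ≡ just ps × length ps ≤ c + D)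
proofIn-atMostPlus x t bound with proofIn x t | bound
... | just ps | just length≤ = ps , refl , length≤

proofIn-belt : ∀ x m ms {D} → chainCost x (map proj₂ (m ∷ ms)) ≡ just D →
  ∃[ ps ] (proofIn x (chain (List⁺.map rangeRoot (ranges m ms))) ≡ just ps × length ps ≤ 2 + D)
proofIn-belt x m ms cost≡ =
  proofIn-atMostPlus x (chain (List⁺.map rangeRoot (ranges m ms)))
    (subst (AtMostPlus 2 _) (trans (cong (chainCost x ∘ map proj₂) (concat-rangesFrom nothing m ms)) cost≡)
      (proofLength-chain-of-chains x proj₂ (ranges m ms)))

membershipProof-bound : ∀ n x → 0 < x → x ≤ n →
  ∃[ j ] ∃[ ps ] (membershipProof n x ≡ just ps × length ps ≤ 2 * j + 3 × 2 ^ j + x ≤ suc n)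
membershipProof-bound n x 0<x x≤n with ummb n | layout-chainCost x (layout-ummb n) 0<x x≤n
... | m ∷ ms | j , D , cost≡ , D≤ , fits with proofIn-belt x m ms cost≡
...   | ps , proof≡ , length≤ =
  j , ps , proof≡ , ≤-trans length≤ (≤-trans (+-monoʳ-≤ 2 D≤) (≤-reflexive (2+[2*n+1]≡2*n+3 j))) , fits

lemma16 : (n k : ℕ) → 1 ≤ k → k ≤ n →
    ∃[ ps ] (membershipProof n (n ∸ k + 1) ≡ just ps
             × length ps ≤ 2 * ⌊log₂ k ⌋ + 3)
lemma16 n k 1≤k k≤n =
  let (j , ps , proof≡ , length≤ , fits) = membershipProof-bound n x (m≤n+m 1 (n ∸ k)) x≤n
  in ps , proof≡ , ≤-trans length≤ (+-monoˡ-≤ 3 (*-monoʳ-≤ 2 (j≤⌊log₂k⌋ j fits)))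
  where
  x : ℕ
  x = n ∸ k + 1
  x+k≡1+n : x + k ≡ suc n
  x+k≡1+n = trans (+-assoc (n ∸ k) 1 k) (trans (+-suc (n ∸ k) k) (cong suc (m∸n+n≡m k≤n)))
  x≤n : x ≤ n
  x≤n = ≤-trans (+-monoʳ-≤ (n ∸ k) 1≤k) (≤-reflexive (m∸n+n≡m k≤n))
  j≤⌊log₂k⌋ : ∀ j → 2 ^ j + x ≤ suc n → j ≤ ⌊log₂ k ⌋
  j≤⌊log₂k⌋ j fits = subst (_≤ ⌊log₂ k ⌋) (⌊log₂[2^n]⌋≡n j) (⌊log₂⌋-mono-≤ 2^j≤k)
    where
    2^j≤k : 2 ^ j ≤ k
    2^j≤k = +-cancelʳ-≤ x (2 ^ j) k (subst (2 ^ j + x ≤_) (trans (sym x+k≡1+n) (+-comm x k)) fits)
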